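{- Let $\mathcal{A}$ be the set of all functions $f:\mathbb{N}\to\mathbb{C}$. Then the $\mathbb{C}$-algebras $(\mathcal{A},+,\circ,\mathbb{C})$ and $(\mathcal{A},+,*,\mathbb{C})$ are isomorphic, and the map $f\mapsto f/\xi$ (pointwise quotient) is an algebra isomorphism from the first onto the second. In particular $f\circ g=\xi\left(\frac{f}{\xi}*\frac{g}{\xi}\right)$ for all $f,g\in\mathcal{A}$.
   Context: For $n\in\mathbb{N}$ write $n=\prod_p p^{\nu_p(n)}$ (canonical prime factorization). The Dirichlet convolution is $(f*g)(n)=\sum_{d\mid n}f(d)g(n/d)$. The binomial convolution is $(f\circ g)(n)=\sum_{d\mid n}\left(\prod_p\binom{\nu_p(n)}{\nu_p(d)}\right)f(d)g(n/d)$. Both algebras use pointwise addition and pointwise scalar multiplication. The function $\xi:\mathbb{N}\to\mathbb{N}$ is $\xi(n)=\prod_p \nu_p(n)!$. -}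

module Defs where

open import Level using (Level; _⊔_)
open import Algebra.Bundles using (CommutativeRing)
open import Data.Nat as ℕ using (ℕ; zero; suc; _/_; _^_; NonZero)
open import Data.Nat.Divisibility using (_∣?_)
open import Data.Nat.Primality using (prime?)
open import Data.Nat.Combinatorics using (_C_)
open import Data.Nat.Base using (_!)
open import Data.List using (List; []; _∷_; filter; length; upTo; map; foldr)
open import Relation.Nullary using (¬_; does)
open import Data.Bool using (if_then_else_)
open import Data.Product using () renaming (Σ to Σ')

productℕ : List ℕ → ℕ
productℕ = foldr ℕ._*_ 1

primesUpTo : ℕ → List ℕ
primesUpTo n = filter prime? (upTo (suc n))

-- ν p n : the exponent of p in n, defined as the number of k ∈ {1,…,n}
-- with p ^ k ∣ n.  For p prime and n ≥ 1 this is exactly ν_p(n)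
-- (p^k ∣ n forces p^k ≤ n hence k < n).
ν : ℕ → ℕ → ℕ
ν p n = length (filter (λ k → p ^ suc k ∣? n) (upTo n))

-- ξ(n) = ∏_p ν_p(n)!   (primes p not dividing n contribute 0! = 1)
ξ : ℕ → ℕ
ξ n = productℕ (map (λ p → ν p n !) (primesUpTo n))

binomℕ : ℕ → ℕ → ℕ
binomℕ n d = productℕ (map (λ p → ν p n C ν p d) (primesUpTo n))

-- Fields of characteristic zero (ℂ is one); the stdlib has no fields.

natToRing : ∀ {c ℓ} (R : CommutativeRing c ℓ) → ℕ → CommutativeRing.Carrier R
natToRing R zero    = CommutativeRing.0# R
natToRing R (suc n) = CommutativeRing._+_ R (CommutativeRing.1# R) (natToRing R n)

record CharZeroField (c ℓ : Level) : Set (Level.suc (c ⊔ ℓ)) where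
  field
    commRing : CommutativeRing c ℓ
  open CommutativeRing commRing public
  field
    _⁻¹       : Carrier → Carrier
    ⁻¹-cong    : ∀ {x y} → x ≈ y → x ⁻¹ ≈ y ⁻¹
    ⁻¹-inverse : ∀ x → ¬ (x ≈ 0#) → x * (x ⁻¹) ≈ 1#

    charZero : ∀ n → ¬ (natToRing commRing (suc n) ≈ 0#)

-- Arithmetic functions ℕ → K (value at 0 is irrelevant; all equalities
-- are only required at n ≥ 1).

module Arith {c ℓ} (K : CharZeroField c ℓ) where
  open CharZeroField K

  ι : ℕ → Carrier
  ι = natToRing commRing

  ArithFun : Set c
  ArithFun = ℕ → Carrier

  _≐_ : ArithFun → ArithFun → Set ℓ
  f ≐ g = ∀ n → .{{_ : NonZero n}} → f n ≈ g n

  Σ : List Carrier → Carrier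
  Σ = foldr _+_ 0#

  _⊕_ : ArithFun → ArithFun → ArithFun
  (f ⊕ g) n = f n + g n

  _·_ : Carrier → ArithFun → ArithFun
  (a · f) n = a * f n

  _⋆_ : ArithFun → ArithFun → ArithFun
  (f ⋆ g) n = Σ (map (λ k → if does (suc k ∣? n)
                              then f (suc k) * g (n / suc k)
                              else 0#) (upTo n))

  _⊚_ : ArithFun → ArithFun → ArithFun
  (f ⊚ g) n = Σ (map (λ k → if does (suc k ∣? n)
                              then ι (binomℕ n (suc k)) * (f (suc k) * g (n / suc k))
                              else 0#) (upTo n))

  ξK : ArithFun
  ξK n = ι (ξ n)

  _/ξ : ArithFun → ArithFun
  (f /ξ) n = f n * (ξK n ⁻¹)

  ξ×_ : ArithFun → ArithFun
  (ξ× f) n = ξK n * f n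

  δ : ArithFun
  δ 1 = 1#
  δ _ = 0#

  record IsAlgebraIso (Φ : ArithFun → ArithFun) : Set (c ⊔ ℓ) where
    field
      resp-≐      : ∀ f g → f ≐ g → Φ f ≐ Φ g
      additive    : ∀ f g → Φ (f ⊕ g) ≐ (Φ f ⊕ Φ g)
      homogeneous : ∀ a f → Φ (a · f) ≐ (a · Φ f)
      multiplicative : ∀ f g → Φ (f ⊚ g) ≐ (Φ f ⋆ Φ g)
      unital      : Φ δ ≐ δ
      injective   : ∀ f g → Φ f ≐ Φ g → f ≐ g
      surjective  : ∀ g → Σ' ArithFun (λ f → Φ f ≐ g)

{-# OPTIONS --safe #-}
-- Since ν_p is additive, C(a+b, a) · a! · b! = (a+b)! at every prime gives
-- binomℕ n d · ξ(d) · ξ(n/d) = ξ(n) for d ∣ n.  Hence the d-th term of f ⊚ g is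
-- ξ(n) times the d-th term of (f/ξ) ⋆ (g/ξ), and pointwise division by the
-- nowhere-vanishing ξ is a linear bijection carrying ⊚ to ⋆.
module Submission where

open import Defs
open import Level using (Level)
open import Data.Product using (_×_; _,_)

module Valuation where
  open import Data.Nat
  open import Data.Nat.Properties
  open import Data.Nat.Divisibility
  open import Algebra.Properties.CommutativeSemigroup *-commutativeSemigroup
    using () renaming (interchange to *-interchange)
  open import Data.Nat.Induction using (<-rec)
  open import Data.Nat.Primality using (Prime; prime?; euclidsLemma; prime⇒nonTrivial)
  open import Data.Nat.Combinatorics using (_C_; nCk≡n!/k![n-k]!; k![n∸k]!∣n!)
  open import Data.Nat.DivMod using (m/n*n≡m)
  open import Data.List using ([]; _∷_; [_]; _++_; filter; length; map; upTo)
  open import Data.List.Properties using (upTo-∷ʳ; filter-++; length-++; map-++; map-cong-local)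
  open import Data.List.Relation.Unary.All as All using (All)
  open import Data.List.Relation.Unary.All.Properties using (all-filter; map⁺)
  open import Data.Nat.ListAction using (product)
  open import Data.Nat.ListAction.Properties using (product-++; product≢0)
  open import Data.Product using (∃₂)
  open import Data.Sum using ([_,_]′)
  open import Function using (_∘_)
  open import Induction.WellFounded using (WfRec)
  open import Relation.Nullary using (¬_; yes; no; contradiction)
  open import Relation.Unary using (Pred; Decidable)
  open import Relation.Binary.PropositionalEquality
    using (_≡_; refl; sym; trans; cong; cong₂; subst; subst₂; module ≡-Reasoning)

  length-filter-upTo : ∀ {p} {P : Pred ℕ p} (P? : Decidable P) {v} →
    (∀ {k} → P k → k < v) → (∀ {k} → k < v → P k) →
    ∀ n → length (filter P? (upTo n)) ≡ n ⊓ v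
  length-filter-upTo P? P⇒<v <v⇒P zero = refl
  length-filter-upTo P? {v} P⇒<v <v⇒P (suc n) = begin
    length (filter P? (upTo (suc n)))                      ≡⟨ cong (length ∘ filter P?) (upTo-∷ʳ n) ⟨
    length (filter P? (upTo n ++ [ n ]))                   ≡⟨ cong length (filter-++ P? (upTo n) [ n ]) ⟩
    length (filter P? (upTo n) ++ filter P? [ n ])         ≡⟨ length-++ (filter P? (upTo n)) ⟩
    length (filter P? (upTo n)) + length (filter P? [ n ]) ≡⟨ cong (_+ _) (length-filter-upTo P? P⇒<v <v⇒P n) ⟩
    n ⊓ v + length (filter P? [ n ])                       ≡⟨ count-last ⟩
    suc n ⊓ v                                              ∎
    where
    open ≡-Reasoning
    count-last : n ⊓ v + length (filter P? [ n ]) ≡ suc n ⊓ v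
    count-last with P? n
    ... | yes Pn = begin
      n ⊓ v + 1   ≡⟨ cong (_+ 1) (m≤n⇒m⊓n≡m (<⇒≤ (P⇒<v Pn))) ⟩
      n + 1       ≡⟨ +-comm n 1 ⟩
      suc n       ≡⟨ m≤n⇒m⊓n≡m (P⇒<v Pn) ⟨
      suc n ⊓ v   ∎
    ... | no ¬Pn = begin
      n ⊓ v + 0   ≡⟨ +-identityʳ _ ⟩
      n ⊓ v       ≡⟨ m≥n⇒m⊓n≡n v≤n ⟩
      v           ≡⟨ m≥n⇒m⊓n≡n (m≤n⇒m≤1+n v≤n) ⟨
      suc n ⊓ v   ∎
      where
      v≤n : v ≤ n
      v≤n = ≮⇒≥ (¬Pn ∘ <v⇒P)

  n<m^n : ∀ {m} → 1 < m → ∀ n → n < m ^ n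
  n<m^n 1<m zero    = z<s
  n<m^n {m} 1<m (suc n) = begin-strict
    suc n          <⟨ s≤s (n<m^n 1<m n) ⟩
    suc (m ^ n)    ≤⟨ +-monoˡ-≤ (m ^ n) (≤-trans z<s (n<m^n 1<m n)) ⟩
    m ^ n + m ^ n  ≡⟨ cong (m ^ n +_) (+-identityʳ (m ^ n)) ⟨
    2 * m ^ n      ≤⟨ *-monoˡ-≤ (m ^ n) 1<m ⟩
    m * m ^ n      ∎
    where open ≤-Reasoning

  ^-monoʳ-∣ : ∀ m {i j} → i ≤ j → m ^ i ∣ m ^ j
  ^-monoʳ-∣ m {i} {j} i≤j = divides (m ^ (j ∸ i)) (begin
    m ^ j                ≡⟨ cong (m ^_) (m+[n∸m]≡n i≤j) ⟨
    m ^ (i + (j ∸ i))    ≡⟨ ^-distribˡ-+-* m i (j ∸ i) ⟩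
    m ^ i * m ^ (j ∸ i)  ≡⟨ *-comm (m ^ i) _ ⟩
    m ^ (j ∸ i) * m ^ i  ∎)
    where open ≡-Reasoning

  PowerSplit : ℕ → ℕ → Set
  PowerSplit p m = ∃₂ λ v r → NonZero r × m ≡ p ^ v * r × ¬ p ∣ r

  powerSplit : ∀ {p} → 1 < p → ∀ m → .{{NonZero m}} → PowerSplit p m
  powerSplit {p} 1<p m =
    <-rec (λ m → NonZero m → PowerSplit p m) split m (>-nonZero (>-nonZero⁻¹ m))
    where
    split : ∀ m → WfRec _<_ (λ m → NonZero m → PowerSplit p m) m → NonZero m → PowerSplit p m
    split m rec m≢0 with p ∣? m
    ... | no p∤m = 0 , m , m≢0 , sym (*-identityˡ m) , p∤m
    ... | yes (divides q m≡q*p) with rec q<m q≢0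
      where
      q≢0 : NonZero q
      q≢0 = m*n≢0⇒m≢0 q {{subst NonZero m≡q*p m≢0}}
      q<m : q < m
      q<m = subst (q <_) (sym m≡q*p) (m<m*n q p {{q≢0}} 1<p)
    ... | v , r , r≢0 , q≡p^v*r , p∤r = suc v , r , r≢0 , m≡ , p∤r
      where
      m≡ : m ≡ p ^ suc v * r
      m≡ = begin
        m                ≡⟨ m≡q*p ⟩
        q * p            ≡⟨ cong (_* p) q≡p^v*r ⟩
        p ^ v * r * p    ≡⟨ *-assoc (p ^ v) r p ⟩
        p ^ v * (r * p)  ≡⟨ cong (p ^ v *_) (*-comm r p) ⟩
        p ^ v * (p * r)  ≡⟨ *-assoc (p ^ v) p r ⟨
        p ^ v * p * r    ≡⟨ cong (_* r) (*-comm (p ^ v) p) ⟩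
        p ^ suc v * r    ∎
        where open ≡-Reasoning

  m≡p^v*r⇒ν≡v : ∀ {p m v r} → 1 < p → .{{NonZero r}} → m ≡ p ^ v * r → ¬ p ∣ r → ν p m ≡ v
  m≡p^v*r⇒ν≡v {p} {m} {v} {r} 1<p m≡p^v*r p∤r = begin
    ν p m  ≡⟨ length-filter-upTo (λ k → p ^ suc k ∣? m) p^[1+k]∣m⇒k<v k<v⇒p^[1+k]∣m m ⟩
    m ⊓ v  ≡⟨ m≥n⇒m⊓n≡n v≤m ⟩
    v      ∎
    where
    open ≡-Reasoning
    instance
      p^v≢0 : NonZero (p ^ v)
      p^v≢0 = m^n≢0 p v {{>-nonZero (<-trans z<s 1<p)}}
    p^v∣m : p ^ v ∣ m
    p^v∣m = divides r (trans m≡p^v*r (*-comm (p ^ v) r))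
    v≤m : v ≤ m
    v≤m = ≤-trans (<⇒≤ (n<m^n 1<p v)) (subst (p ^ v ≤_) (sym m≡p^v*r) (m≤m*n (p ^ v) r))
    k<v⇒p^[1+k]∣m : ∀ {k} → k < v → p ^ suc k ∣ m
    k<v⇒p^[1+k]∣m k<v = ∣-trans (^-monoʳ-∣ p k<v) p^v∣m
    p^[1+k]∣m⇒k<v : ∀ {k} → p ^ suc k ∣ m → k < v
    p^[1+k]∣m⇒k<v {k} p^[1+k]∣m with k <? v
    ... | yes k<v = k<v
    ... | no k≮v = contradiction p∣r p∤r
      where
      p^v*p∣p^v*r : p ^ v * p ∣ p ^ v * r
      p^v*p∣p^v*r = subst₂ _∣_ (*-comm p (p ^ v)) m≡p^v*r
                      (∣-trans (^-monoʳ-∣ p (s≤s (≮⇒≥ k≮v))) p^[1+k]∣m)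
      p∣r : p ∣ r
      p∣r = *-cancelˡ-∣ (p ^ v) p^v*p∣p^v*r

  d<p⇒ν≡0 : ∀ {p d} → d < p → ν p d ≡ 0
  d<p⇒ν≡0 {d = zero}  _   = refl
  d<p⇒ν≡0 {p} {d@(suc _)} d<p = m≡p^v*r⇒ν≡v (≤-trans (s≤s z<s) d<p) (sym (*-identityˡ d)) p∤d
    where
    p∤d : ¬ p ∣ d
    p∤d p∣d = <⇒≱ d<p (∣⇒≤ p∣d)

  ν[d*e]≡νd+νe : ∀ {p} → Prime p → ∀ d e → .{{NonZero d}} → .{{NonZero e}} →
    ν p (d * e) ≡ ν p d + ν p e
  ν[d*e]≡νd+νe {p} pp d e = from-splits (powerSplit 1<p d) (powerSplit 1<p e)
    where
    1<p : 1 < p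
    1<p = nonTrivial⇒n>1 p {{prime⇒nonTrivial pp}}
    from-splits : PowerSplit p d → PowerSplit p e → ν p (d * e) ≡ ν p d + ν p e
    from-splits (a , r , r≢0 , d≡p^a*r , p∤r) (b , s , s≢0 , e≡p^b*s , p∤s) = begin
      ν p (d * e)    ≡⟨ m≡p^v*r⇒ν≡v 1<p {{m*n≢0 r s {{r≢0}} {{s≢0}}}} de≡p^[a+b]*rs p∤rs ⟩
      a + b          ≡⟨ cong₂ _+_ νd≡a νe≡b ⟨
      ν p d + ν p e  ∎
      where
      open ≡-Reasoning
      νd≡a : ν p d ≡ a
      νd≡a = m≡p^v*r⇒ν≡v 1<p {{r≢0}} d≡p^a*r p∤r
      νe≡b : ν p e ≡ b
      νe≡b = m≡p^v*r⇒ν≡v 1<p {{s≢0}} e≡p^b*s p∤s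
      p∤rs : ¬ p ∣ r * s
      p∤rs p∣rs = [ p∤r , p∤s ]′ (euclidsLemma r s pp p∣rs)
      de≡p^[a+b]*rs : d * e ≡ p ^ (a + b) * (r * s)
      de≡p^[a+b]*rs = begin
        d * e                      ≡⟨ cong₂ _*_ d≡p^a*r e≡p^b*s ⟩
        (p ^ a * r) * (p ^ b * s)  ≡⟨ *-interchange (p ^ a) r (p ^ b) s ⟩
        (p ^ a * p ^ b) * (r * s)  ≡⟨ cong (_* (r * s)) (^-distribˡ-+-* p a b) ⟨
        p ^ (a + b) * (r * s)      ∎

  nCk*[k!*[n∸k]!]≡n! : ∀ {n k} → k ≤ n → (n C k) * (k ! * (n ∸ k) !) ≡ n !
  nCk*[k!*[n∸k]!]≡n! {n} {k} k≤n = begin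
    (n C k) * (k ! * (n ∸ k) !)                  ≡⟨ cong (_* (k ! * (n ∸ k) !)) (nCk≡n!/k![n-k]! k≤n) ⟩
    n ! / (k ! * (n ∸ k) !) * (k ! * (n ∸ k) !)  ≡⟨ m/n*n≡m (k![n∸k]!∣n! k≤n) ⟩
    n !                                          ∎
    where
    open ≡-Reasoning
    instance _ = k !* (n ∸ k) !≢0

  νC*ν!*ν!≡ν! : ∀ {p} → Prime p → ∀ d e → .{{NonZero d}} → .{{NonZero e}} →
    (ν p (d * e) C ν p d) * (ν p d ! * ν p e !) ≡ ν p (d * e) !
  νC*ν!*ν!≡ν! {p} pp d e = begin
    (ν p (d * e) C a) * (a ! * b !)        ≡⟨ cong (λ m → (m C a) * (a ! * b !)) νde≡a+b ⟩
    ((a + b) C a) * (a ! * b !)            ≡⟨ cong (λ m → ((a + b) C a) * (a ! * m !)) (m+n∸m≡n a b) ⟨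
    ((a + b) C a) * (a ! * (a + b ∸ a) !)  ≡⟨ nCk*[k!*[n∸k]!]≡n! (m≤m+n a b) ⟩
    (a + b) !                              ≡⟨ cong _! νde≡a+b ⟨
    ν p (d * e) !                          ∎
    where
    open ≡-Reasoning
    a = ν p d
    b = ν p e
    νde≡a+b : ν p (d * e) ≡ a + b
    νde≡a+b = ν[d*e]≡νd+νe pp d e

  product-map-* : ∀ {a} {A : Set a} (f g : A → ℕ) xs →
    product (map (λ x → f x * g x) xs) ≡ product (map f xs) * product (map g xs)
  product-map-* f g []       = refl
  product-map-* f g (x ∷ xs) = begin
    f x * g x * product (map (λ x → f x * g x) xs)         ≡⟨ cong (f x * g x *_) (product-map-* f g xs) ⟩
    f x * g x * (product (map f xs) * product (map g xs))  ≡⟨ *-interchange (f x) (g x) _ _ ⟩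
    f x * product (map f xs) * (g x * product (map g xs))  ∎
    where open ≡-Reasoning

  product-primesUpTo-stable : ∀ (f : ℕ → ℕ) {M} → (∀ {p} → M < p → f p ≡ 1) →
    ∀ {N} → M ≤′ N → product (map f (primesUpTo N)) ≡ product (map f (primesUpTo M))
  product-primesUpTo-stable f f≡1 ≤′-refl = refl
  product-primesUpTo-stable f {M} f≡1 (≤′-step {N} M≤′N) = begin
    product (map f (primesUpTo (suc N)))
      ≡⟨ cong (product ∘ map f ∘ filter prime?) (upTo-∷ʳ (suc N)) ⟨
    product (map f (filter prime? (upTo (suc N) ++ [ suc N ])))
      ≡⟨ cong (product ∘ map f) (filter-++ prime? (upTo (suc N)) [ suc N ]) ⟩
    product (map f (primesUpTo N ++ filter prime? [ suc N ]))
      ≡⟨ cong product (map-++ f (primesUpTo N) _) ⟩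
    product (map f (primesUpTo N) ++ map f (filter prime? [ suc N ]))
      ≡⟨ product-++ (map f (primesUpTo N)) _ ⟩
    product (map f (primesUpTo N)) * product (map f (filter prime? [ suc N ]))
      ≡⟨ cong₂ _*_ (product-primesUpTo-stable f f≡1 M≤′N) new-factor≡1 ⟩
    product (map f (primesUpTo M)) * 1
      ≡⟨ *-identityʳ _ ⟩
    product (map f (primesUpTo M)) ∎
    where
    open ≡-Reasoning
    new-factor≡1 : product (map f (filter prime? [ suc N ])) ≡ 1
    new-factor≡1 with prime? (suc N)
    ... | yes _ = cong (_* 1) (f≡1 (s≤s (≤′⇒≤ M≤′N)))
    ... | no _  = refl

  ξ-primesUpTo : ∀ {d N} → d ≤ N → product (map (λ p → ν p d !) (primesUpTo N)) ≡ ξ d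
  ξ-primesUpTo d≤N = product-primesUpTo-stable _ (λ d<p → cong _! (d<p⇒ν≡0 d<p)) (≤⇒≤′ d≤N)

  binomℕ*[ξ*ξ]≡ξ : ∀ d e → .{{NonZero d}} → .{{NonZero e}} →
    binomℕ (d * e) d * (ξ d * ξ e) ≡ ξ (d * e)
  binomℕ*[ξ*ξ]≡ξ d e = begin
    binomℕ n d * (ξ d * ξ e)
      ≡⟨ cong₂ (λ x y → binomℕ n d * (x * y)) (ξ-primesUpTo d≤n) (ξ-primesUpTo e≤n) ⟨
    product (map B L) * (product (map X L) * product (map Y L))
      ≡⟨ cong (product (map B L) *_) (product-map-* X Y L) ⟨
    product (map B L) * product (map (λ p → X p * Y p) L)
      ≡⟨ product-map-* B _ L ⟨
    product (map (λ p → B p * (X p * Y p)) L)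
      ≡⟨ cong product (map-cong-local (All.map (λ pp → νC*ν!*ν!≡ν! pp d e) L-primes)) ⟩
    ξ n ∎
    where
    open ≡-Reasoning
    n = d * e
    L = primesUpTo n
    L-primes : All Prime L
    L-primes = all-filter prime? (upTo (suc n))
    B = λ p → ν p n C ν p d
    X = λ p → ν p d !
    Y = λ p → ν p e !
    d≤n : d ≤ n
    d≤n = m≤m*n d e
    e≤n : e ≤ n
    e≤n = m≤n*m e d

  ξ≢0 : ∀ n → NonZero (ξ n)
  ξ≢0 n = product≢0 (map⁺ (All.universal (λ p → ν p n !≢0) (primesUpTo n)))

module Isomorphism {c ℓ} (K : CharZeroField c ℓ) where
  open import Data.Nat as ℕ using (ℕ; zero; suc; NonZero)
  open import Data.Nat.Divisibility using (_∣_; _∣?_; ∣⇒≤)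
  open import Data.Nat.DivMod using (m*[n/m]≡n; m≥n⇒m/n>0)
  open import Data.List using ([]; _∷_; map; upTo)
  open import Data.Bool using (if_then_else_)
  open import Relation.Nullary using (¬_; Dec; does; yes; no)
  import Relation.Binary.PropositionalEquality as ≡
  open CharZeroField K
  open Arith K
  open import Algebra.Properties.Semiring.Mult semiring as Mult using (×1-homo-*)
  open import Algebra.Properties.CommutativeSemigroup *-commutativeSemigroup using (interchange)
  open import Relation.Binary.Reasoning.Setoid setoid
  open Valuation using (binomℕ*[ξ*ξ]≡ξ; ξ≢0)

  ι≡×1# : ∀ n → ι n ≡.≡ n Mult.× 1#
  ι≡×1# zero    = ≡.refl
  ι≡×1# (suc n) = ≡.cong (1# +_) (ι≡×1# n)

  ι-* : ∀ m n → ι (m ℕ.* n) ≈ ι m * ι n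
  ι-* m n = begin
    ι (m ℕ.* n)                    ≡⟨ ι≡×1# (m ℕ.* n) ⟩
    (m ℕ.* n) Mult.× 1#            ≈⟨ ×1-homo-* m n ⟩
    (m Mult.× 1#) * (n Mult.× 1#)  ≡⟨ ≡.cong₂ _*_ (ι≡×1# m) (ι≡×1# n) ⟨
    ι m * ι n                      ∎

  ι≉0 : ∀ n → .{{NonZero n}} → ¬ ι n ≈ 0#
  ι≉0 (suc n) = charZero n

  ξK≉0 : ∀ n → ¬ ξK n ≈ 0#
  ξK≉0 n = ι≉0 (ξ n) {{ξ≢0 n}}

  x*[y*x⁻¹]≈y : ∀ {x} → ¬ x ≈ 0# → ∀ y → x * (y * x ⁻¹) ≈ y
  x*[y*x⁻¹]≈y {x} x≉0 y = begin
    x * (y * x ⁻¹)  ≈⟨ *-cong refl (*-comm y (x ⁻¹)) ⟩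
    x * (x ⁻¹ * y)  ≈⟨ *-assoc x (x ⁻¹) y ⟨
    x * x ⁻¹ * y    ≈⟨ *-cong (⁻¹-inverse x x≉0) refl ⟩
    1# * y          ≈⟨ *-identityˡ y ⟩
    y               ∎

  [x*y]*x⁻¹≈y : ∀ {x} → ¬ x ≈ 0# → ∀ y → x * y * x ⁻¹ ≈ y
  [x*y]*x⁻¹≈y {x} x≉0 y = trans (*-assoc x y (x ⁻¹)) (x*[y*x⁻¹]≈y x≉0 y)

  rescale-* : ∀ {b x y z} → ¬ x ≈ 0# → ¬ y ≈ 0# → b * (x * y) ≈ z →
    ∀ u v → b * (u * v) ≈ z * ((u * x ⁻¹) * (v * y ⁻¹))
  rescale-* {b} {x} {y} {z} x≉0 y≉0 b*xy≈z u v = sym (begin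
    z * ((u * x ⁻¹) * (v * y ⁻¹))               ≈⟨ *-cong (sym b*xy≈z) refl ⟩
    b * (x * y) * ((u * x ⁻¹) * (v * y ⁻¹))     ≈⟨ *-assoc b _ _ ⟩
    b * ((x * y) * ((u * x ⁻¹) * (v * y ⁻¹)))   ≈⟨ *-cong refl (interchange x y _ _) ⟩
    b * ((x * (u * x ⁻¹)) * (y * (v * y ⁻¹)))   ≈⟨ *-cong refl (*-cong (x*[y*x⁻¹]≈y x≉0 u) (x*[y*x⁻¹]≈y y≉0 v)) ⟩
    b * (u * v)                                 ∎)

  Σ-map-cong : ∀ {h₁ h₂ : ℕ → Carrier} → (∀ k → h₁ k ≈ h₂ k) → ∀ ks → Σ (map h₁ ks) ≈ Σ (map h₂ ks)
  Σ-map-cong h₁≈h₂ []       = refl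
  Σ-map-cong h₁≈h₂ (k ∷ ks) = +-cong (h₁≈h₂ k) (Σ-map-cong h₁≈h₂ ks)

  *-distribˡ-Σ : ∀ a (h : ℕ → Carrier) ks → a * Σ (map h ks) ≈ Σ (map (λ k → a * h k) ks)
  *-distribˡ-Σ a h []       = zeroʳ a
  *-distribˡ-Σ a h (k ∷ ks) = trans (distribˡ a _ _) (+-cong refl (*-distribˡ-Σ a h ks))

  if-does-*ˡ : ∀ {p} {P : Set p} (D : Dec P) {x y} a → (P → x ≈ a * y) →
    (if does D then x else 0#) ≈ a * (if does D then y else 0#)
  if-does-*ˡ (yes p) a x≈a*y = x≈a*y p
  if-does-*ˡ (no _)  a _     = sym (zeroʳ a)

  binomℕ*[ξK*ξK]≈ξK : ∀ n d → .{{_ : NonZero n}} → .{{_ : NonZero d}} → d ∣ n →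
    ι (binomℕ n d) * (ξK d * ξK (n ℕ./ d)) ≈ ξK n
  binomℕ*[ξK*ξK]≈ξK n d d∣n = begin
    ι (binomℕ n d) * (ξK d * ξK e)       ≈⟨ *-cong refl (ι-* (ξ d) (ξ e)) ⟨
    ι (binomℕ n d) * ι (ξ d ℕ.* ξ e)     ≈⟨ ι-* (binomℕ n d) _ ⟨
    ι (binomℕ n d ℕ.* (ξ d ℕ.* ξ e))     ≡⟨ ≡.cong ι (≡.subst (λ m → binomℕ m d ℕ.* (ξ d ℕ.* ξ e) ≡.≡ ξ m)
                                                       (m*[n/m]≡n d∣n) (binomℕ*[ξ*ξ]≡ξ d e)) ⟩
    ξK n                                 ∎
    where
    e = n ℕ./ d
    instance
      e≢0 : NonZero e
      e≢0 = ℕ.>-nonZero (m≥n⇒m/n>0 (∣⇒≤ d∣n))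

  ⊚-summand≈ξK*⋆-summand : ∀ f g n → .{{NonZero n}} → ∀ k →
    (if does (suc k ∣? n) then ι (binomℕ n (suc k)) * (f (suc k) * g (n ℕ./ suc k)) else 0#)
      ≈ ξK n * (if does (suc k ∣? n) then (f /ξ) (suc k) * (g /ξ) (n ℕ./ suc k) else 0#)
  ⊚-summand≈ξK*⋆-summand f g n k = if-does-*ˡ (suc k ∣? n) (ξK n) λ k+1∣n →
    rescale-* (ξK≉0 (suc k)) (ξK≉0 (n ℕ./ suc k))
      (binomℕ*[ξK*ξK]≈ξK n (suc k) k+1∣n) _ _

  ⊚≐ξ×⋆ : ∀ f g → (f ⊚ g) ≐ (ξ× ((f /ξ) ⋆ (g /ξ)))
  ⊚≐ξ×⋆ f g n = trans (Σ-map-cong (⊚-summand≈ξK*⋆-summand f g n) (upTo n))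
                      (sym (*-distribˡ-Σ (ξK n) _ (upTo n)))

  /ξ-ξ× : ∀ g → ((ξ× g) /ξ) ≐ g
  /ξ-ξ× g n = [x*y]*x⁻¹≈y (ξK≉0 n) (g n)

  ξ×-/ξ : ∀ f → (ξ× (f /ξ)) ≐ f
  ξ×-/ξ f n = x*[y*x⁻¹]≈y (ξK≉0 n) (f n)

  /ξ-δ : (δ /ξ) ≐ δ
  /ξ-δ zero          = zeroˡ _
  /ξ-δ (suc zero)    = begin
    1# * ξK 1 ⁻¹    ≈⟨ *-cong (sym (+-identityʳ 1#)) refl ⟩
    ξK 1 * ξK 1 ⁻¹  ≈⟨ ⁻¹-inverse (ξK 1) (ξK≉0 1) ⟩
    1#              ∎
  /ξ-δ (suc (suc n)) = zeroˡ _

  /ξ-isAlgebraIso : IsAlgebraIso _/ξ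
  /ξ-isAlgebraIso = record
    { resp-≐         = λ f g f≐g n → *-cong (f≐g n) refl
    ; additive       = λ f g n → distribʳ _ (f n) (g n)
    ; homogeneous    = λ a f n → *-assoc a (f n) _
    ; multiplicative = λ f g n → trans (*-cong (⊚≐ξ×⋆ f g n) refl) (/ξ-ξ× ((f /ξ) ⋆ (g /ξ)) n)
    ; unital         = /ξ-δ
    ; injective      = λ f g f/ξ≐g/ξ n → begin
        f n                   ≈⟨ ξ×-/ξ f n ⟨
        ξK n * (f /ξ) n       ≈⟨ *-cong refl (f/ξ≐g/ξ n) ⟩
        ξK n * (g /ξ) n       ≈⟨ ξ×-/ξ g n ⟩
        g n                   ∎
    ; surjective     = λ g → ξ× g , /ξ-ξ× g
    }

theorem2p1 : ∀ {c ℓ : Level} (K : CharZeroField c ℓ) →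
    let open Arith K in
    IsAlgebraIso _/ξ
    × (∀ f g → (f ⊚ g) ≐ (ξ× ((f /ξ) ⋆ (g /ξ))))
theorem2p1 K = /ξ-isAlgebraIso , ⊚≐ξ×⋆
  where open Isomorphism K
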